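{- (Honsberger identity.) For all integers $n, m \ge 0$, \[ Q^P_n\,Q^P_m + Q^P_{n+1}\,Q^P_{m+1} = Q^P_{n+m+1} - P_{n+m+3} + i\,P_{n+m+2} + \varepsilon\,(P_{n+m+3} - 2P_{n+m+5}) + 3\,i\varepsilon\,P_{n+m+4}. \]
   Context: Dual-complex numbers are expressions $x_1 + i\,x_2 + \varepsilon\,y_1 + i\varepsilon\,y_2$ with real coefficients, forming a commutative associative real algebra with basis $\{1,i,\varepsilon,i\varepsilon\}$, where $i^2=-1$, $\varepsilon\ne 0$, $\varepsilon^2=0$, $i\varepsilon=\varepsilon i$, $(i\varepsilon)^2=0$. Pell numbers: $P_0=0$, $P_1=1$, $P_n=2P_{n-1}+P_{n-2}$. The dual-complex Pell quaternion is $Q^P_n = P_n + i\,P_{n+1} + \varepsilon\,P_{n+2} + i\varepsilon\,P_{n+3}$, with products taken in the dual-complex algebra. -}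

module Defs where

open import Data.Nat using (ℕ; zero; suc)
open import Data.Integer using (ℤ; +_; _+_; _-_; _*_)

P : ℕ → ℤ
P zero = + 0
P (suc zero) = + 1
P (suc (suc n)) = + 2 * P (suc n) + P n

-- Dual-complex numbers  x1 + i x2 + ε y1 + iε y2  with integer coefficients
-- (Pell numbers are integers, so ℤ suffices; ℤ ⊂ ℝ).
record DC : Set where
  constructor dc
  field
    re  : ℤ
    im  : ℤ
    du  : ℤ
    idu : ℤ

infixl 6 _⊕_
infixl 7 _⊗_

_⊕_ : DC → DC → DC
dc a b c d ⊕ dc a' b' c' d' = dc (a + a') (b + b') (c + c') (d + d')

-- product from i² = -1, ε² = 0, iε = εi, (iε)² = 0, commutative/associative
_⊗_ : DC → DC → DC
dc a b c d ⊗ dc a' b' c' d' =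
  dc (a * a' - b * b')
     (a * b' + b * a')
     (a * c' + c * a' - b * d' - d * b')
     (a * d' + d * a' + b * c' + c * b')

QP : ℕ → DC
QP n = dc (P n) (P (suc n)) (P (suc (suc n))) (P (suc (suc (suc n))))

-- Every quantity in the identity is a term of a Pell-type sequence, hence an integer
-- combination of two consecutive terms.  The addition formula
-- P_{n+m+1} = P_{n+1} P_{m+1} + P_n P_m (and its shift by one in n) writes the two terms
-- P_{n+m+1}, P_{n+m+2} that determine the right-hand side as bilinear forms in
-- (P_n, P_{n+1}) and (P_m, P_{m+1}).  Both sides are then polynomials in these four
-- numbers, and the identity holds componentwise as a polynomial identity.
module Submission where

open import Defs
open import Data.Nat using (ℕ; zero; suc) renaming (_+_ to _+ℕ_)
open import Data.Nat.Properties using (+-comm)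
open import Data.Integer using (ℤ; +_; -_; _-_; _*_; _+_)
open import Data.Integer.Tactic.RingSolver using (solve-∀; solve)
open import Data.List using (_∷_; [])
open import Data.Product using (_×_; _,_)
open import Relation.Binary.PropositionalEquality
  using (_≡_; refl; cong₂)
open import Relation.Binary.PropositionalEquality.Properties using (module ≡-Reasoning)

P-suc-+ : ∀ n m → P (suc (n +ℕ m)) ≡ P (suc n) * P (suc m) + P n * P m
P-suc-+ zero m = initial (P m) (P (suc m))
  where
  initial : ∀ a b → b ≡ + 1 * b + + 0 * a
  initial = solve-∀
P-suc-+ (suc zero) m = second (P m) (P (suc m))
  where
  second : ∀ a b → + 2 * b + a ≡ (+ 2 * + 1 + + 0) * b + + 1 * a
  second = solve-∀
P-suc-+ (suc (suc n)) m = begin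
  + 2 * P (suc (suc n +ℕ m)) + P (suc (n +ℕ m))
    ≡⟨ cong₂ (λ p q → + 2 * p + q) (P-suc-+ (suc n) m) (P-suc-+ n m) ⟩
  + 2 * (P (suc (suc n)) * P (suc m) + P (suc n) * P m) + (P (suc n) * P (suc m) + P n * P m)
    ≡⟨ regroup (P n) (P (suc n)) (P m) (P (suc m)) ⟩
  P (suc (suc (suc n))) * P (suc m) + P (suc (suc n)) * P m ∎
  where
  open ≡-Reasoning
  regroup : ∀ x y u v →
    + 2 * ((+ 2 * y + x) * v + y * u) + (y * v + x * u)
      ≡ (+ 2 * (+ 2 * y + x) + y) * v + (+ 2 * y + x) * u
  regroup = solve-∀

-- The quaternion of the Pell-type sequence with initial terms a, b; QP n is
-- definitionally pellQuaternion (P n) (P (suc n)).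
pellQuaternion : ℤ → ℤ → DC
pellQuaternion a b = let c = + 2 * b + a in dc a b c (+ 2 * c + b)

-- With b = P_{s+1} and c = P_{s+2} (so d, e, f = P_{s+3}, P_{s+4}, P_{s+5}) this is
-- - P_{s+3} + i P_{s+2} + ε (P_{s+3} - 2 P_{s+5}) + 3 iε P_{s+4}.
honsbergerCorrection : ℤ → ℤ → DC
honsbergerCorrection b c =
  let d = + 2 * c + b ; e = + 2 * d + c ; f = + 2 * e + d
  in dc (- d) c (d - + 2 * f) (+ 3 * e)

honsbergerSide : ℤ → ℤ → DC
honsbergerSide b c = pellQuaternion b c ⊕ honsbergerCorrection b c

dc-cong : ∀ {a b c d a′ b′ c′ d′} →
  a ≡ a′ → b ≡ b′ → c ≡ c′ → d ≡ d′ → dc a b c d ≡ dc a′ b′ c′ d′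
dc-cong refl refl refl refl = refl

-- The four components of the product formula, written out so that the ring solver
-- sees polynomials rather than projections of dual-complex numbers.
honsberger-components : ∀ x y u v →
  let x₂ = + 2 * y + x ; x₃ = + 2 * x₂ + y ; x₄ = + 2 * x₃ + x₂
      u₂ = + 2 * v + u ; u₃ = + 2 * u₂ + v ; u₄ = + 2 * u₃ + u₂
      b = y * v + x * u ; c = x₂ * v + y * u
      d = + 2 * c + b ; e = + 2 * d + c ; f = + 2 * e + d
  in  (x * u - y * v) + (y * v - x₂ * u₂) ≡ b + - d
    × (x * v + y * u) + (y * u₂ + x₂ * v) ≡ c + c
    × (x * u₂ + x₂ * u - y * u₃ - x₃ * v) + (y * u₃ + x₃ * v - x₂ * u₄ - x₄ * u₂)
        ≡ d + (d - + 2 * f)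
    × (x * u₃ + x₃ * u + y * u₂ + x₂ * v) + (y * u₄ + x₄ * v + x₂ * u₃ + x₃ * u₂)
        ≡ e + + 3 * e
honsberger-components x y u v = solve vs , solve vs , solve vs , solve vs
  where vs = x ∷ y ∷ u ∷ v ∷ []

pellQuaternion-honsberger : ∀ x y u v →
  pellQuaternion x y ⊗ pellQuaternion u v
    ⊕ pellQuaternion y (+ 2 * y + x) ⊗ pellQuaternion v (+ 2 * v + u)
  ≡ honsbergerSide (y * v + x * u) ((+ 2 * y + x) * v + y * u)
pellQuaternion-honsberger x y u v =
  let re , im , du , idu = honsberger-components x y u v in dc-cong re im du idu

honsbergerSide-P : ∀ s →
  QP (s +ℕ 1)
    ⊕ dc (- (P (s +ℕ 3))) (P (s +ℕ 2)) (P (s +ℕ 3) - + 2 * P (s +ℕ 5)) (+ 3 * P (s +ℕ 4))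
  ≡ honsbergerSide (P (suc s)) (P (suc (suc s)))
honsbergerSide-P s
  rewrite +-comm s 1 | +-comm s 2 | +-comm s 3 | +-comm s 4 | +-comm s 5 = refl

theorem3p2 : (n m : ℕ) →
    QP n ⊗ QP m ⊕ QP (suc n) ⊗ QP (suc m)
      ≡ QP (n +ℕ m +ℕ 1)
        ⊕ dc (- (P (n +ℕ m +ℕ 3)))
             (P (n +ℕ m +ℕ 2))
             (P (n +ℕ m +ℕ 3) - + 2 * P (n +ℕ m +ℕ 5))
             (+ 3 * P (n +ℕ m +ℕ 4))
theorem3p2 n m = begin
  QP n ⊗ QP m ⊕ QP (suc n) ⊗ QP (suc m)
    ≡⟨ pellQuaternion-honsberger (P n) (P (suc n)) (P m) (P (suc m)) ⟩
  honsbergerSide (P (suc n) * P (suc m) + P n * P m)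
                 (P (suc (suc n)) * P (suc m) + P (suc n) * P m)
    ≡⟨ cong₂ honsbergerSide (P-suc-+ n m) (P-suc-+ (suc n) m) ⟨
  honsbergerSide (P (suc (n +ℕ m))) (P (suc (suc (n +ℕ m))))
    ≡⟨ honsbergerSide-P (n +ℕ m) ⟨
  QP (n +ℕ m +ℕ 1)
    ⊕ dc (- (P (n +ℕ m +ℕ 3)))
         (P (n +ℕ m +ℕ 2))
         (P (n +ℕ m +ℕ 3) - + 2 * P (n +ℕ m +ℕ 5))
         (+ 3 * P (n +ℕ m +ℕ 4)) ∎
  where open ≡-Reasoning
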